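{- Let $k$ and $n$ be integers with $0<k\leq n$. Then \[ I_n(1/k)=n\sum_{j=1}^{\lfloor n/k\rfloor}\frac{\varphi(j)}{j}-k\,\Phi(\lfloor n/k\rfloor)-\sum_{j=1}^{\lfloor n/k\rfloor}\sum_{d\mid j}\mu(d)\left\{\frac{n}{d}\right\}. \]
   Context: For a positive integer $n$, the Farey sequence $F_n$ is the set of irreducible fractions $a/b$ with $0<a/b\leq 1$ and $1\leq b\leq n$ (the fraction $0/1$ is excluded). For $k>0$, $I_n(1/k)$ denotes the number of fractions $\alpha\in F_n$ with $\alpha<1/k$ (the rank of $1/k$ in $F_n$). $\varphi$ is Euler's totient function, $\Phi(m)=\sum_{j=1}^m\varphi(j)$, $\mu$ the Möbius function, and $\{x\}=x-\lfloor x\rfloor$ the fractional part. -}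

module Defs where

open import Data.Nat as ℕ using (ℕ; zero; suc; _≤_; _<_)
open import Data.Nat.GCD using (gcd)
open import Data.Nat.Divisibility using (_∣?_)
open import Data.Nat.Primality using (prime?)
open import Data.Integer as ℤ using (ℤ; +_; -[1+_])
open import Data.Rational as ℚ using (ℚ; 0ℚ; 1ℚ; floor)
open import Data.List using (List; []; _∷_; length; filter; map; concatMap; _++_)
open import Data.List.Relation.Unary.All using (All)
open import Data.Bool using (if_then_else_)
open import Data.Product using (_×_; _,_; proj₁; proj₂)
open import Relation.Nullary using (¬_; does)
open import Relation.Nullary.Decidable using (_×-dec_; ¬?)
open import Data.List.Relation.Unary.All using (all?)

range : ℕ → List ℕ
range zero = []
range (suc m) = range m ++ (suc m ∷ [])

Σℕ : ℕ → (ℕ → ℕ) → ℕ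
Σℕ zero f = 0
Σℕ (suc m) f = Σℕ m f ℕ.+ f (suc m)

Σℚ : ℕ → (ℕ → ℚ) → ℚ
Σℚ zero f = 0ℚ
Σℚ (suc m) f = Σℚ m f ℚ.+ f (suc m)

-- the rational number x / d for natural x, d (only used with d ≥ 1;
-- the value at d = 0 is a junk value never used)
_÷_ : ℕ → ℕ → ℚ
x ÷ zero = 0ℚ
x ÷ suc d = (+ x) ℚ./ suc d

fract : ℚ → ℚ
fract x = x ℚ.- (floor x ℚ./ 1)

φ : ℕ → ℕ
φ j = length (filter (λ i → gcd i j ℕ.≟ 1) (range j))

Φ : ℕ → ℕ
Φ m = Σℕ m φ

squarefree? : (n : ℕ) → _
squarefree? n = all? (λ d → ¬? ((d ℕ.* d) ∣? n)) (filter (λ d → 2 ℕ.≤? d) (range n))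

ω : ℕ → ℕ
ω n = length (filter (λ p → prime? p ×-dec (p ∣? n)) (range n))

μ : ℕ → ℤ
μ n = if does (squarefree? n) then sign (ω n) else + 0
  where
  sign : ℕ → ℤ
  sign zero = + 1
  sign (suc m) = ℤ.- sign m

-- Farey sequence F_n as a list of pairs (a , b) for the fraction a/b:
-- 1 ≤ b ≤ n, 1 ≤ a ≤ b, gcd(a,b) = 1   (so 0 < a/b ≤ 1, irreducible)
farey : ℕ → List (ℕ × ℕ)
farey n = concatMap (λ b → map (λ a → a , b) (filter (λ a → gcd a b ℕ.≟ 1) (range b))) (range n)

-- I_n(1/k) = #{ a/b ∈ F_n : a/b < 1/k }, with a/b < 1/k ⇔ a·k < b (b, k > 0)
I : ℕ → ℕ → ℕ
I n k = length (filter (λ p → (proj₁ p ℕ.* k) ℕ.<? proj₂ p) (farey n))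

-- Count the fractions a/b of F_n below 1/k by their numerator: a fraction with numerator a
-- lies below 1/k iff a k < b ≤ n, so only a ≤ ⌊n/k⌋ occur, and each contributes the number
-- of b in (a k, n] coprime to a.  By Möbius inversion the number of b ≤ x coprime to a is
-- Σ_{d ∣ a} μ(d) ⌊x/d⌋; for x = a k this is k φ(a), and for x = n, writing ⌊n/d⌋ = n/d - {n/d}
-- and using Σ_{d ∣ a} μ(d)/d = φ(a)/a, it is n φ(a)/a - Σ_{d ∣ a} μ(d) {n/d}.  Summing over
-- a ≤ ⌊n/k⌋ gives the formula.

module Submission where

open import Defs

open import Algebra.Bundles using (CommutativeRing)
open import Data.Bool using (Bool; true; false; _∧_; not; if_then_else_)
import Data.Bool.Properties as BoolP
open import Data.Integer as ℤ using (ℤ; +_; -[1+_])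
import Data.Integer.Properties as ℤP
open import Data.List using (List; []; _∷_; _++_; length; filter; map; concatMap)
import Data.List.Properties as ListP
open import Data.List.Membership.Propositional using (_∈_)
open import Data.List.Membership.Propositional.Properties using (∈-++⁺ˡ; ∈-++⁺ʳ; ∈-++⁻; ∈-filter⁺; ∈-filter⁻)
open import Data.List.Relation.Unary.All as All using (All)
open import Data.List.Relation.Unary.Any using (here)
open import Data.Nat as ℕ using (ℕ; zero; suc; _≤_; _<_; z≤n; s≤s; NonZero)
open import Data.Nat.Coprimality as Coprimality using (Coprime)
open import Data.Nat.Divisibility as ℕ∣ using (_∣_; _∣?_; divides)
import Data.Nat.DivMod as ℕD
import Data.Nat.GCD as ℕG
open import Data.Nat.Primality using (Prime; prime?; euclidsLemma; prime⇒irreducible; prime⇒nonTrivial)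
open import Data.Nat.Primality.Factorisation using (factorise)
import Data.Nat.Properties as ℕP
open import Data.Product using (_×_; _,_; proj₁; proj₂; map₂; ∃-syntax)
open import Data.Rational as ℚ using (ℚ; mkℚ; 0ℚ; 1ℚ; ↥_; ↧_; floor)
import Data.Rational.Properties as ℚP
open import Data.Rational.Solver using (module +-*-Solver)
open import Data.Rational.Unnormalised using (mkℚᵘ; *≡*) renaming (_≃_ to _≃ᵘ_; _+_ to _ᵘ+_; _*_ to _ᵘ*_; -_ to ᵘ-_)
import Data.Rational.Unnormalised.Properties as ℚᵘP
open import Data.Sum using (inj₁; inj₂; [_,_]′)
open import Function using (id; _∘_; _⇔_; mk⇔; Equivalence)
open import Level using (Level)
open import Relation.Binary.PropositionalEquality using (_≡_; _≢_; refl; sym; trans; cong; cong₂; subst; subst₂; module ≡-Reasoning)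
open import Relation.Nullary using (¬_; does; yes; no)
open import Relation.Nullary.Decidable using (_×-dec_; dec-true; dec-false; does-⇔)
open import Relation.Nullary.Negation using (contradiction)
open import Relation.Unary using (Decidable)

module FiniteSum {c ℓ : Level} (R : CommutativeRing c ℓ) where
  open CommutativeRing R renaming (refl to ≈-refl; sym to ≈-sym; trans to ≈-trans)
  open import Relation.Binary.Reasoning.Setoid setoid
  open import Algebra.Properties.Ring ring using (-0#≈0#; -‿+-comm)

  ∑ : ℕ → (ℕ → Carrier) → Carrier
  ∑ zero f = 0#
  ∑ (suc m) f = ∑ m f + f (suc m)

  ∑∣ : ℕ → (ℕ → Carrier) → Carrier
  ∑∣ a f = ∑ a (λ d → if does (d ∣? a) then f d else 0#)

  ∑-cong : ∀ m {f g} → (∀ i → 1 ≤ i → i ≤ m → f i ≈ g i) → ∑ m f ≈ ∑ m g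
  ∑-cong zero eq = ≈-refl
  ∑-cong (suc m) eq = +-cong (∑-cong m (λ i 1≤i i≤m → eq i 1≤i (ℕP.m≤n⇒m≤1+n i≤m))) (eq (suc m) (s≤s z≤n) ℕP.≤-refl)

  ∑-zeros : ∀ m {f} → (∀ i → 1 ≤ i → i ≤ m → f i ≈ 0#) → ∑ m f ≈ 0#
  ∑-zeros zero eq = ≈-refl
  ∑-zeros (suc m) eq = ≈-trans (+-cong (∑-zeros m (λ i 1≤i i≤m → eq i 1≤i (ℕP.m≤n⇒m≤1+n i≤m))) (eq (suc m) (s≤s z≤n) ℕP.≤-refl)) (+-identityˡ 0#)

  ∑-distrib-+ : ∀ m f g → ∑ m (λ i → f i + g i) ≈ ∑ m f + ∑ m g
  ∑-distrib-+ zero f g = ≈-sym (+-identityˡ 0#)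
  ∑-distrib-+ (suc m) f g = begin
    ∑ m (λ i → f i + g i) + (f (suc m) + g (suc m)) ≈⟨ +-congʳ (∑-distrib-+ m f g) ⟩
    (∑ m f + ∑ m g) + (f (suc m) + g (suc m))       ≈⟨ +-assoc _ _ _ ⟩
    ∑ m f + (∑ m g + (f (suc m) + g (suc m)))       ≈⟨ +-congˡ (x+[y+z]≈y+[x+z] _ _ _) ⟩
    ∑ m f + (f (suc m) + (∑ m g + g (suc m)))       ≈⟨ +-assoc _ _ _ ⟨
    (∑ m f + f (suc m)) + (∑ m g + g (suc m))       ∎
    where
    x+[y+z]≈y+[x+z] : ∀ x y z → x + (y + z) ≈ y + (x + z)
    x+[y+z]≈y+[x+z] x y z = ≈-trans (≈-sym (+-assoc x y z)) (≈-trans (+-congʳ (+-comm x y)) (+-assoc y x z))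

  ∑-distribˡ-* : ∀ m a f → ∑ m (λ i → a * f i) ≈ a * ∑ m f
  ∑-distribˡ-* zero a f = ≈-sym (zeroʳ a)
  ∑-distribˡ-* (suc m) a f = ≈-trans (+-congʳ (∑-distribˡ-* m a f)) (≈-sym (distribˡ a _ _))

  ∑-distrib-neg : ∀ m f → ∑ m (λ i → - f i) ≈ - ∑ m f
  ∑-distrib-neg zero f = ≈-sym -0#≈0#
  ∑-distrib-neg (suc m) f = ≈-trans (+-congʳ (∑-distrib-neg m f)) (-‿+-comm _ _)

  ∑-distrib-− : ∀ m f g → ∑ m (λ i → f i - g i) ≈ ∑ m f - ∑ m g
  ∑-distrib-− m f g = ≈-trans (∑-distrib-+ m f (λ i → - g i)) (+-congˡ (∑-distrib-neg m g))

  ∑-truncate : ∀ m N {f} → m ≤ N → (∀ i → m < i → i ≤ N → f i ≈ 0#) → ∑ N f ≈ ∑ m f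
  ∑-truncate m zero z≤n eq = ≈-refl
  ∑-truncate m (suc N) m≤N eq with ℕP.m≤n⇒m<n∨m≡n m≤N
  ... | inj₂ refl = ≈-refl
  ... | inj₁ (s≤s m≤N) = ≈-trans (+-cong (∑-truncate m N m≤N (λ i m<i i≤N → eq i m<i (ℕP.m≤n⇒m≤1+n i≤N))) (eq (suc N) (s≤s m≤N) ℕP.≤-refl)) (+-identityʳ _)

  ∑-split : ∀ m p f → ∑ (m ℕ.+ p) f ≈ ∑ m f + ∑ p (λ i → f (m ℕ.+ i))
  ∑-split m zero f rewrite ℕP.+-identityʳ m = ≈-sym (+-identityʳ _)
  ∑-split m (suc p) f rewrite ℕP.+-suc m p = ≈-trans (+-congʳ (∑-split m p f)) (+-assoc _ _ _)

  ∑-comm : ∀ a b (f : ℕ → ℕ → Carrier) → ∑ a (λ i → ∑ b (f i)) ≈ ∑ b (λ j → ∑ a (λ i → f i j))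
  ∑-comm zero b f = ≈-sym (∑-zeros b (λ _ _ _ → ≈-refl))
  ∑-comm (suc a) b f = ≈-trans (+-congʳ (∑-comm a b f)) (≈-sym (∑-distrib-+ b _ _))

  ∑-single : ∀ M p f → 1 ≤ p → p ≤ M → (∀ i → 1 ≤ i → i ≤ M → i ≢ p → f i ≈ 0#) → ∑ M f ≈ f p
  ∑-single M (suc p) f _ p<M eq = begin
    ∑ M f             ≈⟨ ∑-truncate (suc p) M p<M (λ i p<i i≤M → eq i (ℕP.<-trans (s≤s z≤n) p<i) i≤M (ℕP.>⇒≢ p<i)) ⟩
    ∑ p f + f (suc p) ≈⟨ +-congʳ (∑-zeros p (λ i 1≤i i≤p → eq i 1≤i (ℕP.≤-trans (ℕP.m≤n⇒m≤1+n i≤p) p<M) (ℕP.<⇒≢ (s≤s i≤p)))) ⟩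
    0# + f (suc p)    ≈⟨ +-identityˡ _ ⟩
    f (suc p)         ∎

  ∑∣-cong : ∀ a {f g} → (∀ d → 1 ≤ d → d ∣ a → f d ≈ g d) → ∑∣ a f ≈ ∑∣ a g
  ∑∣-cong a {f} {g} eq = ∑-cong a λ d 1≤d _ → pointwise d 1≤d
    where
    pointwise : ∀ d → 1 ≤ d → (if does (d ∣? a) then f d else 0#) ≈ (if does (d ∣? a) then g d else 0#)
    pointwise d 1≤d with d ∣? a
    ... | yes d∣a = eq d 1≤d d∣a
    ... | no _ = ≈-refl

  private
    if-+ : ∀ b x y → (if b then x + y else 0#) ≈ (if b then x else 0#) + (if b then y else 0#)
    if-+ true x y = ≈-refl
    if-+ false x y = ≈-sym (+-identityˡ 0#)

    if-* : ∀ b x y → (if b then x * y else 0#) ≈ x * (if b then y else 0#)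
    if-* true x y = ≈-refl
    if-* false x y = ≈-sym (zeroʳ x)

    if-neg : ∀ b x → (if b then - x else 0#) ≈ - (if b then x else 0#)
    if-neg true x = ≈-refl
    if-neg false x = ≈-sym -0#≈0#

  ∑∣-distrib-+ : ∀ a f g → ∑∣ a (λ d → f d + g d) ≈ ∑∣ a f + ∑∣ a g
  ∑∣-distrib-+ a f g = ≈-trans (∑-cong a (λ d _ _ → if-+ (does (d ∣? a)) (f d) (g d))) (∑-distrib-+ a _ _)

  ∑∣-distribˡ-* : ∀ a x f → ∑∣ a (λ d → x * f d) ≈ x * ∑∣ a f
  ∑∣-distribˡ-* a x f = ≈-trans (∑-cong a (λ d _ _ → if-* (does (d ∣? a)) x (f d))) (∑-distribˡ-* a x _)

  ∑∣-distrib-− : ∀ a f g → ∑∣ a (λ d → f d - g d) ≈ ∑∣ a f - ∑∣ a g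
  ∑∣-distrib-− a f g = ≈-trans (∑∣-distrib-+ a f (λ d → - g d))
    (+-congˡ (≈-trans (∑-cong a (λ d _ _ → if-neg (does (d ∣? a)) (g d))) (∑-distrib-neg a _)))

  ∑-multiples : ∀ p N (F : ℕ → Carrier) → 0 < p → ∑ (N ℕ.* p) (λ d → if does (p ∣? d) then F d else 0#) ≈ ∑ N (λ e → F (e ℕ.* p))
  ∑-multiples p zero F _ = ≈-refl
  ∑-multiples p (suc N) F 0<p = begin
    ∑ (suc N ℕ.* p) G                               ≡⟨ cong (λ m → ∑ m G) (ℕP.+-comm p (N ℕ.* p)) ⟩
    ∑ (N ℕ.* p ℕ.+ p) G                             ≈⟨ ∑-split (N ℕ.* p) p G ⟩
    ∑ (N ℕ.* p) G + ∑ p (λ i → G (N ℕ.* p ℕ.+ i))   ≈⟨ +-cong (∑-multiples p N F 0<p) (∑-single p p _ 0<p ℕP.≤-refl off-multiple) ⟩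
    ∑ N (λ e → F (e ℕ.* p)) + G (N ℕ.* p ℕ.+ p)     ≈⟨ +-congˡ multiple ⟩
    ∑ N (λ e → F (e ℕ.* p)) + F (suc N ℕ.* p)       ∎
    where
    G : ℕ → Carrier
    G d = if does (p ∣? d) then F d else 0#
    off-multiple : ∀ i → 1 ≤ i → i ≤ p → i ≢ p → G (N ℕ.* p ℕ.+ i) ≈ 0#
    off-multiple i 1≤i i≤p i≢p rewrite dec-false (p ∣? N ℕ.* p ℕ.+ i) λ p∣Np+i →
      ℕP.<⇒≱ (ℕP.≤∧≢⇒< i≤p i≢p) (ℕ∣.∣⇒≤ {{ℕ.>-nonZero 1≤i}} (ℕ∣.∣m+n∣m⇒∣n p∣Np+i (ℕ∣.n∣m*n N))) = ≈-refl
    multiple : G (N ℕ.* p ℕ.+ p) ≈ F (suc N ℕ.* p)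
    multiple rewrite dec-true (p ∣? N ℕ.* p ℕ.+ p) (ℕ∣.∣m∣n⇒∣m+n (ℕ∣.n∣m*n N) ℕ∣.∣-refl) = reflexive (cong F (ℕP.+-comm (N ℕ.* p) p))

open FiniteSum ℤP.+-*-commutativeRing

𝟙 : Bool → ℤ
𝟙 true = + 1
𝟙 false = + 0

∈-range⁺ : ∀ {d} n → 1 ≤ d → d ≤ n → d ∈ range n
∈-range⁺ zero 1≤d d≤0 = contradiction (ℕP.≤-trans 1≤d d≤0) λ ()
∈-range⁺ (suc n) 1≤d d≤1+n with ℕP.m≤n⇒m<n∨m≡n d≤1+n
... | inj₁ (s≤s d≤n) = ∈-++⁺ˡ (∈-range⁺ n 1≤d d≤n)
... | inj₂ refl = ∈-++⁺ʳ (range n) (here refl)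

∈-range⁻ : ∀ {d} n → d ∈ range n → 1 ≤ d × d ≤ n
∈-range⁻ (suc n) d∈ with ∈-++⁻ (range n) d∈
... | inj₁ d∈range = map₂ ℕP.m≤n⇒m≤1+n (∈-range⁻ n d∈range)
... | inj₂ (here refl) = s≤s z≤n , ℕP.≤-refl

module _ {a p} {A : Set a} {P : A → Set p} (P? : Decidable P) where

  length-filter-++ : ∀ xs ys → + length (filter P? (xs ++ ys)) ≡ + length (filter P? xs) ℤ.+ + length (filter P? ys)
  length-filter-++ xs ys = begin
    + length (filter P? (xs ++ ys))                  ≡⟨ cong (λ zs → + length zs) (ListP.filter-++ P? xs ys) ⟩
    + length (filter P? xs ++ filter P? ys)          ≡⟨ cong +_ (ListP.length-++ (filter P? xs)) ⟩
    + (length (filter P? xs) ℕ.+ length (filter P? ys)) ≡⟨ ℤP.pos-+ (length (filter P? xs)) _ ⟩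
    + length (filter P? xs) ℤ.+ + length (filter P? ys) ∎
    where open ≡-Reasoning

  length-filter-[_] : ∀ x → + length (filter P? (x ∷ [])) ≡ 𝟙 (does (P? x))
  length-filter-[ x ] with does (P? x)
  ... | true = refl
  ... | false = refl

  length-filter-concatMap-range : (F : ℕ → List A) → ∀ m →
    + length (filter P? (concatMap F (range m))) ≡ ∑ m (λ b → + length (filter P? (F b)))
  length-filter-concatMap-range F zero = refl
  length-filter-concatMap-range F (suc m) = begin
    + length (filter P? (concatMap F (range m ++ suc m ∷ [])))
      ≡⟨ cong (λ zs → + length (filter P? zs)) (ListP.concatMap-++ F (range m) (suc m ∷ [])) ⟩
    + length (filter P? (concatMap F (range m) ++ F (suc m) ++ []))
      ≡⟨ length-filter-++ (concatMap F (range m)) _ ⟩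
    + length (filter P? (concatMap F (range m))) ℤ.+ + length (filter P? (F (suc m) ++ []))
      ≡⟨ cong₂ ℤ._+_ (length-filter-concatMap-range F m) (cong (λ zs → + length (filter P? zs)) (ListP.++-identityʳ (F (suc m)))) ⟩
    ∑ m (λ b → + length (filter P? (F b))) ℤ.+ + length (filter P? (F (suc m))) ∎
    where open ≡-Reasoning

count-range : ∀ {p} {P : ℕ → Set p} (P? : Decidable P) m → + length (filter P? (range m)) ≡ ∑ m (λ i → 𝟙 (does (P? i)))
count-range P? zero = refl
count-range P? (suc m) = trans (length-filter-++ P? (range m) (suc m ∷ [])) (cong₂ ℤ._+_ (count-range P? m) (length-filter-[_] P? (suc m)))

length-filter-map-filter : ∀ {a b p q} {A : Set a} {B : Set b} {P : A → Set p} {Q : B → Set q}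
  (P? : Decidable P) (Q? : Decidable Q) (g : A → B) xs →
  length (filter Q? (map g (filter P? xs))) ≡ length (filter (λ x → P? x ×-dec Q? (g x)) xs)
length-filter-map-filter P? Q? g [] = refl
length-filter-map-filter P? Q? g (x ∷ xs) with does (P? x)
... | false = length-filter-map-filter P? Q? g xs
... | true with does (Q? (g x))
...   | true = cong suc (length-filter-map-filter P? Q? g xs)
...   | false = length-filter-map-filter P? Q? g xs

prime⇒>1 : ∀ {p} → Prime p → 1 < p
prime⇒>1 {p} P = ℕ.nonTrivial⇒n>1 p {{prime⇒nonTrivial P}}

prime⇒>0 : ∀ {p} → Prime p → 0 < p
prime⇒>0 P = ℕP.<-trans (s≤s z≤n) (prime⇒>1 P)

∣prime⇒≡ : ∀ {p q} → Prime p → q ∣ p → 1 < q → q ≡ p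
∣prime⇒≡ P q∣p 1<q with prime⇒irreducible P q∣p
... | inj₁ refl = contradiction 1<q (ℕP.<-irrefl refl)
... | inj₂ q≡p = q≡p

∃-prime-divisor : ∀ d → 1 < d → ∃[ q ] (Prime q × q ∣ d)
∃-prime-divisor d@(suc _) 1<d with factorise d
... | record { factors = [] ; isFactorisation = d≡1 } = contradiction 1<d (ℕP.<-irrefl (sym d≡1))
... | record { factors = q ∷ _ ; isFactorisation = d≡q*qs ; factorsPrime = Pq All.∷ _ } =
  q , Pq , subst (q ∣_) (sym d≡q*qs) (ℕ∣.m∣m*n _)

prime∤⇒coprime : ∀ {p d} → Prime p → ¬ p ∣ d → Coprime d p
prime∤⇒coprime P p∤d (c∣d , c∣p) with prime⇒irreducible P c∣p
... | inj₁ c≡1 = c≡1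
... | inj₂ refl = contradiction c∣d p∤d

Squarefree : ℕ → Set
Squarefree n = ∀ d → 1 < d → d ≤ n → ¬ d ℕ.* d ∣ n

squarefree⇔ : ∀ n → Squarefree n ⇔ All (λ d → ¬ d ℕ.* d ∣ n) (filter (2 ℕ.≤?_) (range n))
squarefree⇔ n = mk⇔
  (λ sf → All.tabulate λ d∈ → let d∈range , 1<d = ∈-filter⁻ (2 ℕ.≤?_) {xs = range n} d∈ in sf _ 1<d (proj₂ (∈-range⁻ n d∈range)))
  (λ all d 1<d d≤n → All.lookup all (∈-filter⁺ (2 ℕ.≤?_) (∈-range⁺ n (ℕP.<⇒≤ 1<d) d≤n) 1<d))

μ-zero : ∀ n → ¬ Squarefree n → μ n ≡ + 0
μ-zero n ¬sf rewrite dec-false (squarefree? n) (¬sf ∘ Equivalence.from (squarefree⇔ n)) = refl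

μ-negate : ∀ m n → does (squarefree? m) ≡ does (squarefree? n) → ω m ≡ suc (ω n) → μ m ≡ ℤ.- μ n
μ-negate m n sf-eq ω-eq with does (squarefree? m) | does (squarefree? n) | ω m | ω n
μ-negate m n refl refl | false | false | _ | _ = refl
μ-negate m n refl refl | true | true | _ | _ = refl

squarefree-*⇒squarefree : ∀ p e → 0 < p → Squarefree (p ℕ.* e) → Squarefree e
squarefree-*⇒squarefree p e 0<p sf d 1<d d≤e dd∣e =
  sf d 1<d (ℕP.≤-trans d≤e (ℕP.m≤n*m e p)) (ℕ∣.∣-trans dd∣e (ℕ∣.n∣m*n p))
  where instance _ = ℕ.>-nonZero 0<p

squarefree-prime* : ∀ p e → Prime p → ¬ p ∣ e → 0 < e → Squarefree e → Squarefree (p ℕ.* e)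
squarefree-prime* p e P p∤e 0<e sf d 1<d _ dd∣pe with p ∣? d
... | yes p∣d = p∤e (ℕ∣.*-cancelˡ-∣ p (ℕ∣.∣-trans (ℕ∣.*-pres-∣ p∣d p∣d) dd∣pe))
  where instance _ = ℕ.>-nonZero (prime⇒>0 P)
... | no p∤d = sf d 1<d d≤e dd∣e
  where
  instance _ = ℕ.>-nonZero 0<e
  p∤dd : ¬ p ∣ d ℕ.* d
  p∤dd p∣dd = [ p∤d , p∤d ]′ (euclidsLemma d d P p∣dd)
  dd∣e : d ℕ.* d ∣ e
  dd∣e = Coprimality.coprime-divisor (prime∤⇒coprime P p∤dd) dd∣pe
  d≤e : d ≤ e
  d≤e = ℕP.≤-trans (ℕP.m≤m*n d d {{ℕ.>-nonZero (ℕP.<-trans (s≤s z≤n) 1<d)}}) (ℕ∣.∣⇒≤ dd∣e)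

ω-prime* : ∀ p e → Prime p → ¬ p ∣ e → 0 < e → ω (p ℕ.* e) ≡ suc (ω e)
ω-prime* p e P p∤e 0<e = ℤP.+-injective (begin
  + ω (p ℕ.* e)                         ≡⟨ count-range (primeDivisor? (p ℕ.* e)) (p ℕ.* e) ⟩
  ∑ (p ℕ.* e) (λ q → 𝟙 (isPrimeDivisor q (p ℕ.* e))) ≡⟨ ∑-cong (p ℕ.* e) (λ q _ _ → split q) ⟩
  ∑ (p ℕ.* e) (λ q → 𝟙 (isPrimeDivisor q e) ℤ.+ 𝟙 (does (q ℕ.≟ p))) ≡⟨ ∑-distrib-+ (p ℕ.* e) _ _ ⟩
  ∑ (p ℕ.* e) (λ q → 𝟙 (isPrimeDivisor q e)) ℤ.+ ∑ (p ℕ.* e) (λ q → 𝟙 (does (q ℕ.≟ p)))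
    ≡⟨ cong₂ ℤ._+_ (∑-truncate e (p ℕ.* e) (ℕP.m≤n*m e p) beyond-e) (∑-single (p ℕ.* e) p _ (prime⇒>0 P) (ℕP.m≤m*n p e) other-than-p) ⟩
  ∑ e (λ q → 𝟙 (isPrimeDivisor q e)) ℤ.+ 𝟙 (does (p ℕ.≟ p)) ≡⟨ cong₂ ℤ._+_ (count-range (primeDivisor? e) e) (cong 𝟙 (sym (dec-true (p ℕ.≟ p) refl))) ⟨
  + ω e ℤ.+ + 1                         ≡⟨ ℤP.+-comm (+ ω e) (+ 1) ⟩
  + suc (ω e)                           ∎)
  where
  open ≡-Reasoning
  instance _ = ℕ.>-nonZero (prime⇒>0 P)
  instance _ = ℕ.>-nonZero 0<e
  primeDivisor? : ∀ n → Decidable (λ q → Prime q × q ∣ n)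
  primeDivisor? n q = prime? q ×-dec q ∣? n
  isPrimeDivisor : ℕ → ℕ → Bool
  isPrimeDivisor q n = does (primeDivisor? n q)
  split : ∀ q → 𝟙 (isPrimeDivisor q (p ℕ.* e)) ≡ 𝟙 (isPrimeDivisor q e) ℤ.+ 𝟙 (does (q ℕ.≟ p))
  split q with q ℕ.≟ p
  ... | yes refl rewrite dec-true (prime? p) P | dec-true (p ∣? p ℕ.* e) (ℕ∣.m∣m*n e) | dec-false (p ∣? e) p∤e | dec-true (p ℕ.≟ p) refl = refl
  ... | no q≢p rewrite dec-false (q ℕ.≟ p) q≢p with prime? q
  ...   | no _ = refl
  ...   | yes Q = trans (cong 𝟙 (does-⇔ q∣pe⇔q∣e (q ∣? p ℕ.* e) (q ∣? e))) (sym (ℤP.+-identityʳ _))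
    where
    q∣pe⇔q∣e : q ∣ p ℕ.* e ⇔ q ∣ e
    q∣pe⇔q∣e = mk⇔ (λ q∣pe → [ (λ q∣p → contradiction (∣prime⇒≡ P q∣p (prime⇒>1 Q)) q≢p) , id ]′ (euclidsLemma p e Q q∣pe))
                   (λ q∣e → ℕ∣.∣-trans q∣e (ℕ∣.n∣m*n p))
  beyond-e : ∀ q → e < q → q ≤ p ℕ.* e → 𝟙 (isPrimeDivisor q e) ≡ + 0
  beyond-e q e<q _ rewrite dec-false (q ∣? e) (λ q∣e → ℕP.<⇒≱ e<q (ℕ∣.∣⇒≤ q∣e)) = cong 𝟙 (BoolP.∧-zeroʳ _)
  other-than-p : ∀ q → 1 ≤ q → q ≤ p ℕ.* e → q ≢ p → 𝟙 (does (q ℕ.≟ p)) ≡ + 0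
  other-than-p q _ _ q≢p rewrite dec-false (q ℕ.≟ p) q≢p = refl

μ-prime*-∣ : ∀ p e → Prime p → p ∣ e → 0 < e → μ (p ℕ.* e) ≡ + 0
μ-prime*-∣ p e P p∣e 0<e = μ-zero (p ℕ.* e) λ sf → sf p (prime⇒>1 P) (ℕP.m≤m*n p e) (ℕ∣.*-monoʳ-∣ p p∣e)
  where instance _ = ℕ.>-nonZero 0<e

μ-prime*-∤ : ∀ p e → Prime p → ¬ p ∣ e → 0 < e → μ (p ℕ.* e) ≡ ℤ.- μ e
μ-prime*-∤ p e P p∤e 0<e = μ-negate (p ℕ.* e) e
  (does-⇔ (mk⇔ (to (squarefree⇔ e) ∘ squarefree-*⇒squarefree p e (prime⇒>0 P) ∘ from (squarefree⇔ (p ℕ.* e)))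
               (to (squarefree⇔ (p ℕ.* e)) ∘ squarefree-prime* p e P p∤e 0<e ∘ from (squarefree⇔ e)))
    (squarefree? (p ℕ.* e)) (squarefree? e))
  (ω-prime* p e P p∤e 0<e)
  where open Equivalence

-- The divisors d of N p with p ∤ d are the divisors of N prime to p; those with p ∣ d are
-- the e p with e ∣ N, and μ (e p) is 0 when p ∣ e and - μ e otherwise, so the two parts cancel.
∑∣-μ-multiple-of-prime : ∀ p N → Prime p → 0 < N → ∑∣ (N ℕ.* p) μ ≡ + 0
∑∣-μ-multiple-of-prime p N P 0<N = begin
  ∑∣ g μ                                         ≡⟨ ∑-cong g (λ d _ _ → split d) ⟩
  ∑ g (λ d → A d ℤ.+ B d)                         ≡⟨ ∑-distrib-+ g A B ⟩
  ∑ g A ℤ.+ ∑ g B                                 ≡⟨ cong₂ ℤ._+_ (∑-truncate N g (ℕP.m≤m*n N p) beyond-N) (∑-multiples p N h (prime⇒>0 P)) ⟩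
  ∑ N A ℤ.+ ∑ N (λ e → h (e ℕ.* p))               ≡⟨ cong (λ x → ∑ N A ℤ.+ x) (trans (∑-cong N (λ e 0<e _ → h[ep]≡-Ae e 0<e)) (∑-distrib-neg N A)) ⟩
  ∑ N A ℤ.- ∑ N A                                 ≡⟨ ℤP.+-inverseʳ (∑ N A) ⟩
  + 0                                             ∎
  where
  open ≡-Reasoning
  instance _ = ℕ.>-nonZero (prime⇒>0 P)
  instance _ = ℕ.>-nonZero 0<N
  g = N ℕ.* p
  h A B : ℕ → ℤ
  h d = if does (d ∣? g) then μ d else + 0
  A d = if does (d ∣? N) then (if does (p ∣? d) then + 0 else μ d) else + 0
  B d = if does (p ∣? d) then h d else + 0
  ∣g⇔∣N : ∀ {d} → ¬ p ∣ d → d ∣ g ⇔ d ∣ N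
  ∣g⇔∣N {d} p∤d = mk⇔ (Coprimality.coprime-divisor (prime∤⇒coprime P p∤d) ∘ subst (d ∣_) (ℕP.*-comm N p)) (λ d∣N → ℕ∣.∣-trans d∣N (ℕ∣.m∣m*n p))
  split : ∀ d → h d ≡ A d ℤ.+ B d
  split d with p ∣? d
  ... | yes _ with d ∣? N
  ...   | yes _ = sym (ℤP.+-identityˡ (h d))
  ...   | no _ = sym (ℤP.+-identityˡ (h d))
  split d | no p∤d rewrite does-⇔ (∣g⇔∣N p∤d) (d ∣? g) (d ∣? N) = sym (ℤP.+-identityʳ _)
  beyond-N : ∀ d → N < d → d ≤ g → A d ≡ + 0
  beyond-N d N<d _ rewrite dec-false (d ∣? N) (λ d∣N → ℕP.<⇒≱ N<d (ℕ∣.∣⇒≤ d∣N)) = refl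
  *p∣g⇔∣N : ∀ e → e ℕ.* p ∣ g ⇔ e ∣ N
  *p∣g⇔∣N e = mk⇔ (ℕ∣.*-cancelˡ-∣ p ∘ subst₂ _∣_ (ℕP.*-comm e p) (ℕP.*-comm N p)) (ℕ∣.*-monoˡ-∣ p)
  h[ep]≡-Ae : ∀ e → 0 < e → h (e ℕ.* p) ≡ ℤ.- A e
  h[ep]≡-Ae e 0<e rewrite does-⇔ (*p∣g⇔∣N e) (e ℕ.* p ∣? g) (e ∣? N) with e ∣? N
  ... | no _ = refl
  ... | yes _ with p ∣? e
  ...   | yes p∣e = trans (cong μ (ℕP.*-comm e p)) (μ-prime*-∣ p e P p∣e 0<e)
  ...   | no p∤e = trans (cong μ (ℕP.*-comm e p)) (μ-prime*-∤ p e P p∤e 0<e)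

∑∣-μ : ∀ g → 0 < g → ∑∣ g μ ≡ 𝟙 (does (g ℕ.≟ 1))
∑∣-μ 1 _ = refl
∑∣-μ g@(suc (suc _)) _ with ∃-prime-divisor g (s≤s (s≤s z≤n))
... | p , P , divides (suc N) g≡[1+N]p = subst (λ m → ∑∣ m μ ≡ + 0) (sym g≡[1+N]p) (∑∣-μ-multiple-of-prime p (suc N) P (s≤s z≤n))

-- ⌊ x / d ⌋, with the junk value 0 at d = 0 so that it can be summed over d without instance arguments.
infixl 7 _div_
_div_ : ℕ → ℕ → ℕ
x div zero = 0
x div suc d = x ℕ./ suc d

/-suc-∣ : ∀ x d → suc d ∣ suc x → suc x ℕ./ suc d ≡ suc (x ℕ./ suc d)
/-suc-∣ x d (divides zero ())
/-suc-∣ x d (divides (suc c) 1+x≡[1+c]D) = begin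
  suc x ℕ./ D                 ≡⟨ ℕD./-congˡ {o = D} 1+x≡[1+c]D ⟩
  suc c ℕ.* D ℕ./ D           ≡⟨ ℕD.m*n/n≡m (suc c) D ⟩
  suc c                       ≡⟨ cong suc x/D≡c ⟨
  suc (x ℕ./ D)               ∎
  where
  open ≡-Reasoning
  D = suc d
  x/D≡c : x ℕ./ D ≡ c
  x/D≡c = begin
    x ℕ./ D                   ≡⟨ ℕD./-congˡ {o = D} (trans (ℕP.suc-injective 1+x≡[1+c]D) (ℕP.+-comm d (c ℕ.* D))) ⟩
    (c ℕ.* D ℕ.+ d) ℕ./ D     ≡⟨ ℕD.+-distrib-/-∣ˡ d (ℕ∣.n∣m*n c) ⟩
    c ℕ.* D ℕ./ D ℕ.+ d ℕ./ D ≡⟨ cong₂ ℕ._+_ (ℕD.m*n/n≡m c D) (ℕD.m<n⇒m/n≡0 (ℕP.n<1+n d)) ⟩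
    c ℕ.+ 0                   ≡⟨ ℕP.+-identityʳ c ⟩
    c                         ∎

/-suc-∤ : ∀ x d → ¬ suc (suc d) ∣ suc x → suc x ℕ./ suc (suc d) ≡ x ℕ./ suc (suc d)
/-suc-∤ x d D∤1+x = begin
  suc x ℕ./ D                 ≡⟨ ℕD./-congˡ {o = D} (ℕP.+-comm 1 x) ⟩
  (x ℕ.+ 1) ℕ./ D             ≡⟨ ℕD.+-distrib-/ x 1 r+1<D ⟩
  x ℕ./ D ℕ.+ 1 ℕ./ D         ≡⟨ ℕP.+-identityʳ _ ⟩
  x ℕ./ D                     ∎
  where
  open ≡-Reasoning
  D = suc (suc d)
  r = x ℕ.% D
  r+1≢D : r ℕ.+ 1 ≢ D
  r+1≢D r+1≡D = D∤1+x (divides (suc (x ℕ./ D)) (begin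
    suc x                     ≡⟨ cong suc (ℕD.m≡m%n+[m/n]*n x D) ⟩
    suc (r ℕ.+ x ℕ./ D ℕ.* D) ≡⟨ cong (ℕ._+ x ℕ./ D ℕ.* D) (trans (ℕP.+-comm 1 r) r+1≡D) ⟩
    D ℕ.+ x ℕ./ D ℕ.* D       ∎))
  r+1<D : r ℕ.+ 1 ℕ.% D < D
  r+1<D = ℕP.≤∧≢⇒< (subst (_≤ D) (ℕP.+-comm 1 r) (ℕD.m%n<n x D)) r+1≢D

suc-div : ∀ x d → 0 < d → + (suc x div d) ≡ + (x div d) ℤ.+ 𝟙 (does (d ∣? suc x))
suc-div x d@(suc d′) _ with d ∣? suc x
... | yes d∣1+x rewrite dec-true (d ∣? suc x) d∣1+x =
  trans (cong +_ (trans (/-suc-∣ x d′ d∣1+x) (ℕP.+-comm 1 _))) (ℤP.pos-+ _ 1)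
suc-div x 1 _ | no 1∤1+x = contradiction (ℕ∣.1∣ _) 1∤1+x
suc-div x d@(suc (suc d″)) _ | no d∤1+x rewrite dec-false (d ∣? suc x) d∤1+x =
  trans (cong +_ (/-suc-∤ x d″ d∤1+x)) (sym (ℤP.+-identityʳ _))

div-*ˡ : ∀ a k d → d ∣ a → (a ℕ.* k) div d ≡ k ℕ.* (a div d)
div-*ˡ a k zero _ = sym (ℕP.*-zeroʳ k)
div-*ˡ a k (suc d) d∣a = trans (ℕD./-congˡ (ℕP.*-comm a k)) (ℕD.*-/-assoc k d∣a)

coprimeCount : ℕ → ℕ → ℤ
coprimeCount a x = ∑ x (λ b → 𝟙 (does (ℕG.gcd b a ℕ.≟ 1)))

φ≡coprimeCount : ∀ a → + φ a ≡ coprimeCount a a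
φ≡coprimeCount a = count-range (λ i → ℕG.gcd i a ℕ.≟ 1) a

∑∣-μ-common-divisors : ∀ a x → 0 < a → ∑∣ a (λ d → μ d ℤ.* 𝟙 (does (d ∣? x))) ≡ 𝟙 (does (ℕG.gcd x a ℕ.≟ 1))
∑∣-μ-common-divisors a x 0<a = begin
  ∑∣ a (λ d → μ d ℤ.* 𝟙 (does (d ∣? x)))  ≡⟨ ∑-cong a (λ d _ _ → pointwise d) ⟩
  ∑ a (λ d → if does (d ∣? g) then μ d else + 0) ≡⟨ ∑-truncate g a g≤a beyond-g ⟩
  ∑∣ g μ                                 ≡⟨ ∑∣-μ g 0<g ⟩
  𝟙 (does (g ℕ.≟ 1))                     ∎
  where
  open ≡-Reasoning
  instance _ = ℕ.>-nonZero 0<a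
  g = ℕG.gcd x a
  0<g : 0 < g
  0<g = ℕP.n≢0⇒n>0 (ℕG.gcd[m,n]≢0 x a (inj₂ (ℕP.n>0⇒n≢0 0<a)))
  g≤a : g ≤ a
  g≤a = ℕ∣.∣⇒≤ (ℕG.gcd[m,n]∣n x a)
  ∣g⇔∣a×∣x : ∀ d → d ∣ g ⇔ (d ∣ a × d ∣ x)
  ∣g⇔∣a×∣x d = mk⇔ (λ d∣g → ℕ∣.∣-trans d∣g (ℕG.gcd[m,n]∣n x a) , ℕ∣.∣-trans d∣g (ℕG.gcd[m,n]∣m x a))
                   (λ (d∣a , d∣x) → ℕG.gcd-greatest d∣x d∣a)
  pointwise : ∀ d → (if does (d ∣? a) then μ d ℤ.* 𝟙 (does (d ∣? x)) else + 0) ≡ (if does (d ∣? g) then μ d else + 0)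
  pointwise d rewrite does-⇔ (∣g⇔∣a×∣x d) (d ∣? g) (d ∣? a ×-dec d ∣? x) with d ∣? a | d ∣? x
  ... | yes _ | yes _ = ℤP.*-identityʳ (μ d)
  ... | yes _ | no _ = ℤP.*-zeroʳ (μ d)
  ... | no _ | _ = refl
  beyond-g : ∀ d → g < d → d ≤ a → (if does (d ∣? g) then μ d else + 0) ≡ + 0
  beyond-g d g<d _ rewrite dec-false (d ∣? g) (λ d∣g → ℕP.<⇒≱ g<d (ℕ∣.∣⇒≤ {{ℕ.>-nonZero 0<g}} d∣g)) = refl

coprimeCount≡∑∣μ : ∀ a x → 0 < a → coprimeCount a x ≡ ∑∣ a (λ d → μ d ℤ.* + (x div d))
coprimeCount≡∑∣μ a zero 0<a = sym (begin
  ∑∣ a (λ d → μ d ℤ.* + (0 div d)) ≡⟨ ∑∣-cong a (λ d _ _ → trans (cong (λ z → μ d ℤ.* + z) (0-div d)) (ℤP.*-comm (μ d) (+ 0))) ⟩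
  ∑∣ a (λ d → + 0 ℤ.* μ d)         ≡⟨ ∑∣-distribˡ-* a (+ 0) μ ⟩
  + 0 ℤ.* ∑∣ a μ                   ≡⟨ ℤP.*-zeroˡ (∑∣ a μ) ⟩
  + 0                              ∎)
  where
  open ≡-Reasoning
  0-div : ∀ d → 0 div d ≡ 0
  0-div zero = refl
  0-div (suc d) = refl
coprimeCount≡∑∣μ a (suc x) 0<a = sym (begin
  ∑∣ a (λ d → μ d ℤ.* + (suc x div d))
    ≡⟨ ∑∣-cong a (λ d 0<d _ → trans (cong (μ d ℤ.*_) (suc-div x d 0<d)) (ℤP.*-distribˡ-+ (μ d) _ _)) ⟩
  ∑∣ a (λ d → μ d ℤ.* + (x div d) ℤ.+ μ d ℤ.* 𝟙 (does (d ∣? suc x)))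
    ≡⟨ ∑∣-distrib-+ a _ _ ⟩
  ∑∣ a (λ d → μ d ℤ.* + (x div d)) ℤ.+ ∑∣ a (λ d → μ d ℤ.* 𝟙 (does (d ∣? suc x)))
    ≡⟨ cong₂ ℤ._+_ (sym (coprimeCount≡∑∣μ a x 0<a)) (∑∣-μ-common-divisors a (suc x) 0<a) ⟩
  coprimeCount a (suc x) ∎)
  where open ≡-Reasoning

φ≡∑∣μ : ∀ a → 0 < a → + φ a ≡ ∑∣ a (λ d → μ d ℤ.* + (a div d))
φ≡∑∣μ a 0<a = trans (φ≡coprimeCount a) (coprimeCount≡∑∣μ a a 0<a)

coprimeCount-multiple : ∀ a k → 0 < a → coprimeCount a (a ℕ.* k) ≡ + k ℤ.* + φ a
coprimeCount-multiple a k 0<a = begin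
  coprimeCount a (a ℕ.* k)                  ≡⟨ coprimeCount≡∑∣μ a (a ℕ.* k) 0<a ⟩
  ∑∣ a (λ d → μ d ℤ.* + ((a ℕ.* k) div d))  ≡⟨ ∑∣-cong a (λ d _ d∣a → pull-k d d∣a) ⟩
  ∑∣ a (λ d → + k ℤ.* (μ d ℤ.* + (a div d))) ≡⟨ ∑∣-distribˡ-* a (+ k) _ ⟩
  + k ℤ.* ∑∣ a (λ d → μ d ℤ.* + (a div d))   ≡⟨ cong (+ k ℤ.*_) (φ≡∑∣μ a 0<a) ⟨
  + k ℤ.* + φ a                             ∎
  where
  open ≡-Reasoning
  pull-k : ∀ d → d ∣ a → μ d ℤ.* + ((a ℕ.* k) div d) ≡ + k ℤ.* (μ d ℤ.* + (a div d))
  pull-k d d∣a = begin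
    μ d ℤ.* + ((a ℕ.* k) div d)     ≡⟨ cong (λ z → μ d ℤ.* + z) (div-*ˡ a k d d∣a) ⟩
    μ d ℤ.* + (k ℕ.* (a div d))     ≡⟨ cong (μ d ℤ.*_) (ℤP.pos-* k (a div d)) ⟩
    μ d ℤ.* (+ k ℤ.* + (a div d))   ≡⟨ ℤP.*-assoc (μ d) (+ k) _ ⟨
    (μ d ℤ.* + k) ℤ.* + (a div d)   ≡⟨ cong (ℤ._* + (a div d)) (ℤP.*-comm (μ d) (+ k)) ⟩
    (+ k ℤ.* μ d) ℤ.* + (a div d)   ≡⟨ ℤP.*-assoc (+ k) (μ d) _ ⟩
    + k ℤ.* (μ d ℤ.* + (a div d))   ∎

𝟙-split : ∀ b c → 𝟙 b ≡ 𝟙 (b ∧ c) ℤ.+ 𝟙 (b ∧ not c)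
𝟙-split true true = refl
𝟙-split true false = refl
𝟙-split false c = refl

coprimeCount-interval : ∀ a m n → m ≤ n →
  ∑ n (λ b → 𝟙 (does (ℕG.gcd a b ℕ.≟ 1) ∧ does (m ℕ.<? b))) ≡ coprimeCount a n ℤ.- coprimeCount a m
coprimeCount-interval a m n m≤n = sym (begin
  coprimeCount a n ℤ.- coprimeCount a m                     ≡⟨ cong (ℤ._- coprimeCount a m) split ⟩
  ∑ n above ℤ.+ ∑ n (λ b → 𝟙 (coprime b ∧ not (does (m ℕ.<? b)))) ℤ.- coprimeCount a m
    ≡⟨ cong (λ z → ∑ n above ℤ.+ z ℤ.- coprimeCount a m) (trans (∑-truncate m n m≤n beyond-m) (∑-cong m up-to-m)) ⟩
  ∑ n above ℤ.+ coprimeCount a m ℤ.- coprimeCount a m        ≡⟨ //-rightDividesʳ (coprimeCount a m) (∑ n above) ⟩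
  ∑ n above                                                 ∎)
  where
  open ≡-Reasoning
  open import Algebra.Properties.Group (CommutativeRing.+-group ℤP.+-*-commutativeRing) using (//-rightDividesʳ)
  coprime : ℕ → Bool
  coprime b = does (ℕG.gcd b a ℕ.≟ 1)
  above : ℕ → ℤ
  above b = 𝟙 (does (ℕG.gcd a b ℕ.≟ 1) ∧ does (m ℕ.<? b))
  split : coprimeCount a n ≡ ∑ n above ℤ.+ ∑ n (λ b → 𝟙 (coprime b ∧ not (does (m ℕ.<? b))))
  split = trans (∑-cong n (λ b _ _ → split-term b)) (∑-distrib-+ n above _)
    where
    split-term : ∀ b → 𝟙 (coprime b) ≡ above b ℤ.+ 𝟙 (coprime b ∧ not (does (m ℕ.<? b)))
    split-term b = trans (𝟙-split (coprime b) (does (m ℕ.<? b)))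
      (cong (λ c → 𝟙 (does (c ℕ.≟ 1) ∧ does (m ℕ.<? b)) ℤ.+ 𝟙 (coprime b ∧ not (does (m ℕ.<? b)))) (ℕG.gcd-comm b a))
  beyond-m : ∀ b → m < b → b ≤ n → 𝟙 (coprime b ∧ not (does (m ℕ.<? b))) ≡ + 0
  beyond-m b m<b _ rewrite dec-true (m ℕ.<? b) m<b = cong 𝟙 (BoolP.∧-zeroʳ (coprime b))
  up-to-m : ∀ b → 1 ≤ b → b ≤ m → 𝟙 (coprime b ∧ not (does (m ℕ.<? b))) ≡ 𝟙 (coprime b)
  up-to-m b _ b≤m rewrite dec-false (m ℕ.<? b) (ℕP.≤⇒≯ b≤m) = cong 𝟙 (BoolP.∧-identityʳ (coprime b))

I≡∑∑ : ∀ n k → + I n k ≡ ∑ n (λ b → ∑ b (λ a → 𝟙 (does (ℕG.gcd a b ℕ.≟ 1) ∧ does (a ℕ.* k ℕ.<? b))))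
I≡∑∑ n k = trans (length-filter-concatMap-range below _ n) (∑-cong n λ b _ _ →
  trans (cong +_ (length-filter-map-filter (λ a → ℕG.gcd a b ℕ.≟ 1) below (_, b) (range b))) (count-range _ b))
  where
  below : Decidable (λ (p : ℕ × ℕ) → proj₁ p ℕ.* k < proj₂ p)
  below p = proj₁ p ℕ.* k ℕ.<? proj₂ p

I≡∑coprimeCount : ∀ n k .{{_ : NonZero k}} → + I n k ≡ ∑ (n ℕ./ k) (λ a → coprimeCount a n ℤ.- + k ℤ.* + φ a)
I≡∑coprimeCount n k = begin
  + I n k                                ≡⟨ I≡∑∑ n k ⟩
  ∑ n (λ b → ∑ b (λ a → fareyTerm a b))   ≡⟨ ∑-cong n (λ b _ b≤n → sym (∑-truncate b n b≤n (λ a b<a _ → no-a>b a b b<a))) ⟩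
  ∑ n (λ b → ∑ n (λ a → fareyTerm a b))   ≡⟨ ∑-comm n n (λ b a → fareyTerm a b) ⟩
  ∑ n (λ a → ∑ n (fareyTerm a))           ≡⟨ ∑-truncate q n (ℕD.m/n≤m n k) (λ a q<a _ → ∑-zeros n (λ b _ b≤n → no-a>q a b q<a b≤n)) ⟩
  ∑ q (λ a → ∑ n (fareyTerm a))           ≡⟨ ∑-cong q (λ a 0<a a≤q → trans (coprimeCount-interval a (a ℕ.* k) n (ak≤n a≤q))
                                                        (cong (λ x → coprimeCount a n ℤ.- x) (coprimeCount-multiple a k 0<a))) ⟩
  ∑ q (λ a → coprimeCount a n ℤ.- + k ℤ.* + φ a) ∎
  where
  open ≡-Reasoning
  q = n ℕ./ k
  fareyTerm : ℕ → ℕ → ℤ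
  fareyTerm a b = 𝟙 (does (ℕG.gcd a b ℕ.≟ 1) ∧ does (a ℕ.* k ℕ.<? b))
  ak≤n⇒a≤q : ∀ {a} → a ℕ.* k ≤ n → a ≤ q
  ak≤n⇒a≤q {a} ak≤n = subst (_≤ q) (ℕD.m*n/n≡m a k) (ℕD./-monoˡ-≤ k ak≤n)
  vanishes : ∀ a b → ¬ a ℕ.* k < b → fareyTerm a b ≡ + 0
  vanishes a b ak≮b rewrite dec-false (a ℕ.* k ℕ.<? b) ak≮b = cong 𝟙 (BoolP.∧-zeroʳ _)
  no-a>b : ∀ a b → b < a → fareyTerm a b ≡ + 0
  no-a>b a b b<a = vanishes a b λ ak<b → ℕP.<-asym b<a (ℕP.≤-<-trans (ℕP.m≤m*n a k) ak<b)
  no-a>q : ∀ a b → q < a → b ≤ n → fareyTerm a b ≡ + 0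
  no-a>q a b q<a b≤n = vanishes a b λ ak<b → ℕP.<⇒≱ q<a (ak≤n⇒a≤q (ℕP.<⇒≤ (ℕP.<-≤-trans ak<b b≤n)))
  ak≤n : ∀ {a} → a ≤ q → a ℕ.* k ≤ n
  ak≤n a≤q = ℕP.≤-trans (ℕP.*-monoˡ-≤ k a≤q) (ℕD.m/n*n≤m n k)

ι : ℤ → ℚ
ι z = z ℚ./ 1

toℚᵘ-/ : ∀ i m → ℚ.toℚᵘ (i ℚ./ suc m) ≃ᵘ mkℚᵘ i m
toℚᵘ-/ i m = ℚP.toℚᵘ-fromℚᵘ (mkℚᵘ i m)

ι-homo-+ : ∀ a b → ι (a ℤ.+ b) ≡ ι a ℚ.+ ι b
ι-homo-+ a b = ℚP.toℚᵘ-injective (begin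
  ℚ.toℚᵘ (ι (a ℤ.+ b))              ≈⟨ toℚᵘ-/ (a ℤ.+ b) 0 ⟩
  mkℚᵘ (a ℤ.+ b) 0                  ≈⟨ *≡* (cong (ℤ._* + 1) (cong₂ ℤ._+_ (ℤP.*-identityʳ a) (ℤP.*-identityʳ b))) ⟨
  mkℚᵘ a 0 ᵘ+ mkℚᵘ b 0              ≈⟨ ℚᵘP.+-cong (toℚᵘ-/ a 0) (toℚᵘ-/ b 0) ⟨
  ℚ.toℚᵘ (ι a) ᵘ+ ℚ.toℚᵘ (ι b)      ≈⟨ ℚP.toℚᵘ-homo-+ (ι a) (ι b) ⟨
  ℚ.toℚᵘ (ι a ℚ.+ ι b)              ∎)
  where open ℚᵘP.≃-Reasoning

ι-homo-* : ∀ a b → ι (a ℤ.* b) ≡ ι a ℚ.* ι b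
ι-homo-* a b = ℚP.toℚᵘ-injective (begin
  ℚ.toℚᵘ (ι (a ℤ.* b))              ≈⟨ toℚᵘ-/ (a ℤ.* b) 0 ⟩
  mkℚᵘ a 0 ᵘ* mkℚᵘ b 0              ≈⟨ ℚᵘP.*-cong (toℚᵘ-/ a 0) (toℚᵘ-/ b 0) ⟨
  ℚ.toℚᵘ (ι a) ᵘ* ℚ.toℚᵘ (ι b)      ≈⟨ ℚP.toℚᵘ-homo-* (ι a) (ι b) ⟨
  ℚ.toℚᵘ (ι a ℚ.* ι b)              ∎)
  where open ℚᵘP.≃-Reasoning

ι-homo-neg : ∀ a → ι (ℤ.- a) ≡ ℚ.- ι a
ι-homo-neg a = ℚP.toℚᵘ-injective (begin
  ℚ.toℚᵘ (ι (ℤ.- a))    ≈⟨ toℚᵘ-/ (ℤ.- a) 0 ⟩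
  ᵘ- mkℚᵘ a 0           ≈⟨ ℚᵘP.-‿cong (toℚᵘ-/ a 0) ⟨
  ᵘ- ℚ.toℚᵘ (ι a)       ≈⟨ ℚP.toℚᵘ-homo‿- (ι a) ⟨
  ℚ.toℚᵘ (ℚ.- ι a)      ∎)
  where open ℚᵘP.≃-Reasoning

ι-homo-− : ∀ a b → ι (a ℤ.- b) ≡ ι a ℚ.- ι b
ι-homo-− a b = trans (ι-homo-+ a (ℤ.- b)) (cong (ι a ℚ.+_) (ι-homo-neg b))

*-÷-cancel : ∀ x d → ι (+ suc d) ℚ.* (x ÷ suc d) ≡ ι (+ x)
*-÷-cancel x d = ℚP.toℚᵘ-injective (begin
  ℚ.toℚᵘ (ι (+ suc d) ℚ.* (x ÷ suc d))          ≈⟨ ℚP.toℚᵘ-homo-* (ι (+ suc d)) (x ÷ suc d) ⟩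
  ℚ.toℚᵘ (ι (+ suc d)) ᵘ* ℚ.toℚᵘ (x ÷ suc d)    ≈⟨ ℚᵘP.*-cong (toℚᵘ-/ (+ suc d) 0) (toℚᵘ-/ (+ x) d) ⟩
  mkℚᵘ (+ suc d) 0 ᵘ* mkℚᵘ (+ x) d              ≈⟨ *≡* eq ⟩
  mkℚᵘ (+ x) 0                                  ≈⟨ toℚᵘ-/ (+ x) 0 ⟨
  ℚ.toℚᵘ (ι (+ x))                              ∎)
  where
  open ℚᵘP.≃-Reasoning
  eq : (+ suc d ℤ.* + x) ℤ.* + 1 ≡ + x ℤ.* (+ 1 ℤ.* + suc d)
  eq = trans (ℤP.*-identityʳ _) (trans (ℤP.*-comm (+ suc d) (+ x)) (cong (+ x ℤ.*_) (sym (ℤP.*-identityˡ (+ suc d)))))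

*-cancelˡ-ι-suc : ∀ d x y → ι (+ suc d) ℚ.* x ≡ ι (+ suc d) ℚ.* y → x ≡ y
*-cancelˡ-ι-suc d x y eq = begin
  x                          ≡⟨ ℚP.*-identityˡ x ⟨
  1ℚ ℚ.* x                   ≡⟨ cong (ℚ._* x) 1≡d⁻¹*d ⟩
  (d⁻¹ ℚ.* D) ℚ.* x          ≡⟨ ℚP.*-assoc d⁻¹ D x ⟩
  d⁻¹ ℚ.* (D ℚ.* x)          ≡⟨ cong (d⁻¹ ℚ.*_) eq ⟩
  d⁻¹ ℚ.* (D ℚ.* y)          ≡⟨ ℚP.*-assoc d⁻¹ D y ⟨
  (d⁻¹ ℚ.* D) ℚ.* y          ≡⟨ cong (ℚ._* y) 1≡d⁻¹*d ⟨
  1ℚ ℚ.* y                   ≡⟨ ℚP.*-identityˡ y ⟩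
  y                          ∎
  where
  open ≡-Reasoning
  D = ι (+ suc d)
  d⁻¹ = 1 ÷ suc d
  1≡d⁻¹*d : 1ℚ ≡ d⁻¹ ℚ.* D
  1≡d⁻¹*d = trans (sym (*-÷-cancel 1 d)) (ℚP.*-comm D d⁻¹)

floor-÷ : ∀ x d → floor (x ÷ suc d) ≡ + (x ℕ./ suc d)
floor-÷ x d = floor-reduced (x ÷ suc d) (ℕG.gcd x (suc d)) (ℚP.↥-/ (+ x) (suc d)) (ℚP.↧-/ (+ x) (suc d))
  where
  floor-reduced : ∀ p g → ↥ p ℤ.* + g ≡ + x → ↧ p ℤ.* + g ≡ + suc d → floor p ≡ + (x ℕ./ suc d)
  floor-reduced (mkℚ (+ a) e _) (suc g) ↥p*g≡x ↧p*g≡d = trans (ℤP.*-identityˡ _) (cong +_ (begin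
    a ℕ./ suc e                          ≡⟨ ℕD.m*n/o*n≡m/o a (suc g) (suc e) ⟨
    (a ℕ.* suc g) ℕ./ (suc e ℕ.* suc g)  ≡⟨ ℕD./-congʳ {m = a ℕ.* suc g} (ℤP.+-injective (trans (ℤP.pos-* (suc e) (suc g)) ↧p*g≡d)) ⟩
    (a ℕ.* suc g) ℕ./ suc d              ≡⟨ ℕD./-congˡ (ℤP.+-injective (trans (ℤP.pos-* a (suc g)) ↥p*g≡x)) ⟩
    x ℕ./ suc d                          ∎))
    where open ≡-Reasoning
  floor-reduced (mkℚ -[1+ a ] e _) (suc g) () _
  floor-reduced (mkℚ n e _) zero _ ↧p*0≡d with trans (sym (ℤP.*-zeroʳ (+ suc e))) ↧p*0≡d
  ... | ()

fract-÷ : ∀ x d → fract (x ÷ suc d) ≡ x ÷ suc d ℚ.- ι (+ (x ℕ./ suc d))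
fract-÷ x d = cong (λ z → x ÷ suc d ℚ.- ι z) (floor-÷ x d)

module ℚ∑ = FiniteSum ℚP.+-*-commutativeRing

Σℚ≡∑ : ∀ m f → Σℚ m f ≡ ℚ∑.∑ m f
Σℚ≡∑ zero f = refl
Σℚ≡∑ (suc m) f = cong (ℚ._+ f (suc m)) (Σℚ≡∑ m f)

ι-∑ : ∀ m f → ι (∑ m f) ≡ ℚ∑.∑ m (ι ∘ f)
ι-∑ zero f = refl
ι-∑ (suc m) f = trans (ι-homo-+ (∑ m f) (f (suc m))) (cong (ℚ._+ ι (f (suc m))) (ι-∑ m f))

ι-∑∣ : ∀ a f → ι (∑∣ a f) ≡ ℚ∑.∑∣ a (ι ∘ f)
ι-∑∣ a f = trans (ι-∑ a _) (ℚ∑.∑-cong a λ d _ _ → ι-if (does (d ∣? a)))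
  where
  ι-if : ∀ {d} b → ι (if b then f d else + 0) ≡ (if b then ι (f d) else 0ℚ)
  ι-if true = refl
  ι-if false = refl

+-Σℕ : ∀ m f → + Σℕ m f ≡ ∑ m (λ i → + f i)
+-Σℕ zero f = refl
+-Σℕ (suc m) f = trans (ℤP.pos-+ (Σℕ m f) (f (suc m))) (cong (ℤ._+ + f (suc m)) (+-Σℕ m f))

∑∣-μ-÷ : ∀ n a → 0 < a → ℚ∑.∑∣ a (λ d → ι (μ d) ℚ.* (n ÷ d)) ≡ ι (+ n) ℚ.* (φ a ÷ a)
∑∣-μ-÷ n a@(suc a′) _ = *-cancelˡ-ι-suc a′ _ _ (begin
  A ℚ.* ℚ∑.∑∣ a (λ d → ι (μ d) ℚ.* (n ÷ d))       ≡⟨ ℚ∑.∑∣-distribˡ-* a A _ ⟨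
  ℚ∑.∑∣ a (λ d → A ℚ.* (ι (μ d) ℚ.* (n ÷ d)))      ≡⟨ ℚ∑.∑∣-cong a (λ d 0<d d∣a → clear-denominator d 0<d d∣a) ⟩
  ℚ∑.∑∣ a (λ d → N ℚ.* ι (μ d ℤ.* + (a div d)))   ≡⟨ ℚ∑.∑∣-distribˡ-* a N _ ⟩
  N ℚ.* ℚ∑.∑∣ a (λ d → ι (μ d ℤ.* + (a div d)))   ≡⟨ cong (N ℚ.*_) (trans (cong ι (φ≡∑∣μ a (s≤s z≤n))) (ι-∑∣ a _)) ⟨
  N ℚ.* ι (+ φ a)                                ≡⟨ cong (N ℚ.*_) (*-÷-cancel (φ a) a′) ⟨
  N ℚ.* (A ℚ.* (φ a ÷ a))                        ≡⟨ solve 3 (λ x y z → x :* (y :* z) := y :* (x :* z)) refl N A (φ a ÷ a) ⟩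
  A ℚ.* (N ℚ.* (φ a ÷ a))                        ∎)
  where
  open ≡-Reasoning
  open +-*-Solver
  A = ι (+ a)
  N = ι (+ n)
  clear-denominator : ∀ d → 0 < d → d ∣ a → A ℚ.* (ι (μ d) ℚ.* (n ÷ d)) ≡ N ℚ.* ι (μ d ℤ.* + (a div d))
  clear-denominator d@(suc d′) _ d∣a = begin
    A ℚ.* (ι (μ d) ℚ.* (n ÷ d))                   ≡⟨ cong (ℚ._* (ι (μ d) ℚ.* (n ÷ d))) a≡[a/d]*d ⟩
    (ι (+ q) ℚ.* ι (+ d)) ℚ.* (ι (μ d) ℚ.* (n ÷ d)) ≡⟨ solve 4 (λ w x y z → (w :* x) :* (y :* z) := (y :* w) :* (x :* z)) refl (ι (+ q)) (ι (+ d)) (ι (μ d)) (n ÷ d) ⟩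
    (ι (μ d) ℚ.* ι (+ q)) ℚ.* (ι (+ d) ℚ.* (n ÷ d)) ≡⟨ cong₂ ℚ._*_ (sym (ι-homo-* (μ d) (+ q))) (*-÷-cancel n d′) ⟩
    ι (μ d ℤ.* + q) ℚ.* N                         ≡⟨ ℚP.*-comm _ N ⟩
    N ℚ.* ι (μ d ℤ.* + q)                         ∎
    where
    q = a ℕ./ d
    a≡[a/d]*d : A ≡ ι (+ q) ℚ.* ι (+ d)
    a≡[a/d]*d = trans (cong (ι ∘ +_) (sym (ℕD.m/n*n≡m d∣a))) (trans (cong ι (ℤP.pos-* q d)) (ι-homo-* (+ q) (+ d)))

ι-coprimeCount : ∀ a n → 0 < a → ι (coprimeCount a n)
  ≡ ι (+ n) ℚ.* (φ a ÷ a) ℚ.- Σℚ a (λ d → if does (d ∣? a) then (μ d ℚ./ 1) ℚ.* fract (n ÷ d) else 0ℚ)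
ι-coprimeCount a n 0<a = begin
  ι (coprimeCount a n)                                      ≡⟨ cong ι (coprimeCount≡∑∣μ a n 0<a) ⟩
  ι (∑∣ a (λ d → μ d ℤ.* + (n div d)))                      ≡⟨ ι-∑∣ a _ ⟩
  ℚ∑.∑∣ a (λ d → ι (μ d ℤ.* + (n div d)))                   ≡⟨ ℚ∑.∑∣-cong a (λ d 0<d _ → floor-as-fract d 0<d) ⟩
  ℚ∑.∑∣ a (λ d → ι (μ d) ℚ.* (n ÷ d) ℚ.- ι (μ d) ℚ.* fract (n ÷ d)) ≡⟨ ℚ∑.∑∣-distrib-− a _ _ ⟩
  ℚ∑.∑∣ a (λ d → ι (μ d) ℚ.* (n ÷ d)) ℚ.- ℚ∑.∑∣ a (λ d → ι (μ d) ℚ.* fract (n ÷ d))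
    ≡⟨ cong₂ ℚ._-_ (∑∣-μ-÷ n a 0<a) (sym (Σℚ≡∑ a _)) ⟩
  ι (+ n) ℚ.* (φ a ÷ a) ℚ.- Σℚ a (λ d → if does (d ∣? a) then ι (μ d) ℚ.* fract (n ÷ d) else 0ℚ) ∎
  where
  open ≡-Reasoning
  open +-*-Solver
  floor-as-fract : ∀ d → 0 < d → ι (μ d ℤ.* + (n div d)) ≡ ι (μ d) ℚ.* (n ÷ d) ℚ.- ι (μ d) ℚ.* fract (n ÷ d)
  floor-as-fract d@(suc d′) _ = begin
    ι (μ d ℤ.* + (n div d))                        ≡⟨ ι-homo-* (μ d) _ ⟩
    ι (μ d) ℚ.* ι (+ (n div d))                    ≡⟨ solve 3 (λ m x f → m :* f := m :* x :- m :* (x :- f)) refl (ι (μ d)) (n ÷ d) (ι (+ (n div d))) ⟩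
    ι (μ d) ℚ.* (n ÷ d) ℚ.- ι (μ d) ℚ.* (n ÷ d ℚ.- ι (+ (n div d))) ≡⟨ cong (λ x → ι (μ d) ℚ.* (n ÷ d) ℚ.- ι (μ d) ℚ.* x) (fract-÷ n d′) ⟨
    ι (μ d) ℚ.* (n ÷ d) ℚ.- ι (μ d) ℚ.* fract (n ÷ d) ∎

ι-coprimeCount−kφ : ∀ a n k → 0 < a → ι (coprimeCount a n ℤ.- + k ℤ.* + φ a)
  ≡ ι (+ n) ℚ.* (φ a ÷ a) ℚ.- ι (+ k ℤ.* + φ a) ℚ.- Σℚ a (λ d → if does (d ∣? a) then (μ d ℚ./ 1) ℚ.* fract (n ÷ d) else 0ℚ)
ι-coprimeCount−kφ a n k 0<a = begin
  ι (coprimeCount a n ℤ.- K)            ≡⟨ ι-homo-− (coprimeCount a n) K ⟩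
  ι (coprimeCount a n) ℚ.- ι K          ≡⟨ cong (ℚ._- ι K) (ι-coprimeCount a n 0<a) ⟩
  X ℚ.- S ℚ.- ι K                       ≡⟨ solve 3 (λ x s y → x :- s :- y := x :- y :- s) refl X S (ι K) ⟩
  X ℚ.- ι K ℚ.- S                       ∎
  where
  open ≡-Reasoning
  open +-*-Solver
  K = + k ℤ.* + φ a
  X = ι (+ n) ℚ.* (φ a ÷ a)
  S = Σℚ a (λ d → if does (d ∣? a) then ι (μ d) ℚ.* fract (n ÷ d) else 0ℚ)

∑k*φ≡k*Φ : ∀ k m → ∑ m (λ a → + k ℤ.* + φ a) ≡ + (k ℕ.* Φ m)
∑k*φ≡k*Φ k m = begin
  ∑ m (λ a → + k ℤ.* + φ a)   ≡⟨ ∑-distribˡ-* m (+ k) (λ a → + φ a) ⟩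
  + k ℤ.* ∑ m (λ a → + φ a)   ≡⟨ cong (+ k ℤ.*_) (+-Σℕ m φ) ⟨
  + k ℤ.* + Φ m               ≡⟨ ℤP.pos-* k (Φ m) ⟨
  + (k ℕ.* Φ m)               ∎
  where open ≡-Reasoning

theorem2 : (k n : ℕ) → .{{_ : NonZero k}} → k ≤ n →
    (+ I n k) ℚ./ 1
      ≡ ((+ n) ℚ./ 1) ℚ.* Σℚ (n ℕ./ k) (λ j → φ j ÷ j)
        ℚ.- (+ (k ℕ.* Φ (n ℕ./ k))) ℚ./ 1
        ℚ.- Σℚ (n ℕ./ k) (λ j → Σℚ j (λ d →
              if does (d ∣? j) then (μ d ℚ./ 1) ℚ.* fract (n ÷ d) else 0ℚ))
theorem2 k n _ = begin
  ι (+ I n k)                                           ≡⟨ cong ι (I≡∑coprimeCount n k) ⟩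
  ι (∑ q (λ a → coprimeCount a n ℤ.- K a))              ≡⟨ ι-∑ q _ ⟩
  ℚ∑.∑ q (λ a → ι (coprimeCount a n ℤ.- K a))           ≡⟨ ℚ∑.∑-cong q (λ a 0<a _ → ι-coprimeCount−kφ a n k 0<a) ⟩
  ℚ∑.∑ q (λ a → X a ℚ.- ι (K a) ℚ.- S a)                ≡⟨ trans (ℚ∑.∑-distrib-− q _ S) (cong (ℚ._- ℚ∑.∑ q S) (ℚ∑.∑-distrib-− q X (ι ∘ K))) ⟩
  ℚ∑.∑ q X ℚ.- ℚ∑.∑ q (ι ∘ K) ℚ.- ℚ∑.∑ q S
    ≡⟨ cong₂ (λ x y → x ℚ.- y ℚ.- ℚ∑.∑ q S) ∑X (trans (sym (ι-∑ q K)) (cong ι (∑k*φ≡k*Φ k q))) ⟩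
  N ℚ.* Σℚ q (λ a → φ a ÷ a) ℚ.- ι (+ (k ℕ.* Φ q)) ℚ.- ℚ∑.∑ q S
    ≡⟨ cong (λ x → N ℚ.* Σℚ q (λ a → φ a ÷ a) ℚ.- ι (+ (k ℕ.* Φ q)) ℚ.- x) (sym (Σℚ≡∑ q S)) ⟩
  N ℚ.* Σℚ q (λ a → φ a ÷ a) ℚ.- ι (+ (k ℕ.* Φ q)) ℚ.- Σℚ q S ∎
  where
  open ≡-Reasoning
  q = n ℕ./ k
  N = ι (+ n)
  X : ℕ → ℚ
  X a = N ℚ.* (φ a ÷ a)
  K : ℕ → ℤ
  K a = + k ℤ.* + φ a
  S : ℕ → ℚ
  S a = Σℚ a (λ d → if does (d ∣? a) then ι (μ d) ℚ.* fract (n ÷ d) else 0ℚ)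
  ∑X : ℚ∑.∑ q X ≡ N ℚ.* Σℚ q (λ a → φ a ÷ a)
  ∑X = trans (ℚ∑.∑-distribˡ-* q N _) (cong (N ℚ.*_) (sym (Σℚ≡∑ q _)))
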